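{- For every finite loopless digraph $\mathbf D$ there exists $i\ge 0$ such that $\delta^{(i)}\mathbf D\to\mathbf K_3$.
   Context: The arc digraph $\delta\mathbf D$ of a digraph $\mathbf D$ has as vertices the arcs of $\mathbf D$, and its arcs are the pairs $((u,v),(v,w))$ with $(u,v),(v,w)\in E(D)$; $\delta^{(i)}$ denotes $i$-fold application of $\delta$ ($\delta^{(0)}\mathbf D=\mathbf D$). $\mathbf K_3$ is the digraph on 3 vertices with all arcs between distinct vertices. $\to$ denotes existence of an arc-preserving vertex map. -}

module Defs where

open import Data.Nat using (ℕ; zero; suc)
open import Data.Fin using (Fin)
open import Data.Bool using (Bool; T; false)
open import Data.Product using (Σ; Σ-syntax; _,_; proj₁; proj₂)
open import Relation.Binary.PropositionalEquality using (_≡_; _≢_)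

record Digraph : Set₁ where
  field
    V : Set
    E : V → V → Set
open Digraph public

-- A finite digraph on vertex set Fin n, arcs given by a Boolean adjacency
-- relation (so there is at most one arc (u,v) for each ordered pair).
finDigraph : (n : ℕ) → (Fin n → Fin n → Bool) → Digraph
finDigraph n adj = record { V = Fin n ; E = λ u v → T (adj u v) }

Arc : Digraph → Set
Arc D = Σ[ u ∈ V D ] Σ[ v ∈ V D ] E D u v

tail head : {D : Digraph} → Arc D → V D
tail a = proj₁ a
head a = proj₁ (proj₂ a)

δ : Digraph → Digraph
δ D = record { V = Arc D ; E = λ a b → head {D} a ≡ tail {D} b }

δ^ : ℕ → Digraph → Digraph
δ^ zero D = D
δ^ (suc i) D = δ (δ^ i D)

K₃ : Digraph
K₃ = record { V = Fin 3 ; E = λ x y → x ≢ y }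

_⟶_ : Digraph → Digraph → Set
D ⟶ H = Σ[ f ∈ (V D → V H) ] (∀ {x y} → E D x y → E H (f x) (f y))

-- K(n+1) is K(n) with an apex added. Colour a 2-walk x → y → z of K(n+1) by its middle
-- vertex y when y is not the apex, and otherwise by a vertex of K(n) other than x and z;
-- for n ≥ 3 such a vertex exists, and consecutive 2-walks always get distinct colours.
-- So δ(δ K(n+1)) → K(n), hence δ^(2(n-3)) K(n) → K₃, and a loopless D maps into K(|D|).
module Submission where

open import Defs
open import Data.Nat using (ℕ; zero; suc; _+_; _≤_)
open import Data.Nat.Properties using (m≤n+m)
open import Data.Fin using (Fin; zero; suc; inject≤)
open import Data.Fin.Properties using (inject≤-injective)
open import Data.Bool using (Bool; T; false)
open import Data.Product using (Σ-syntax; _,_; proj₁; proj₂; _×_)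
open import Function using (id)
open import Function.Definitions using (Injective)
open import Relation.Nullary using (¬_)
open import Relation.Binary.PropositionalEquality
  using (_≡_; _≢_; refl; cong; subst; ≢-sym)

_∘ₕ_ : {D G H : Digraph} → G ⟶ H → D ⟶ G → D ⟶ H
(g , g-hom) ∘ₕ (f , f-hom) = (λ x → g (f x)) , (λ e → g-hom (f-hom e))

δ-map : {D H : Digraph} → D ⟶ H → δ D ⟶ δ H
δ-map (f , f-hom) = (λ { (u , v , e) → f u , f v , f-hom e }) , cong f

δ^-map : (i : ℕ) {D H : Digraph} → D ⟶ H → δ^ i D ⟶ δ^ i H
δ^-map zero    h = h
δ^-map (suc i) h = δ-map (δ^-map i h)

δ^-δ : (i : ℕ) (D : Digraph) → δ^ i (δ D) ≡ δ^ (suc i) D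
δ^-δ zero    D = refl
δ^-δ (suc i) D = cong δ (δ^-δ i D)

Complete : Set → Digraph
Complete A = record { V = A ; E = _≢_ }

K : ℕ → Digraph
K n = Complete (Fin n)

Complete-map : {A B : Set} (f : A → B) → Injective _≡_ _≡_ f → Complete A ⟶ Complete B
Complete-map f f-inj = f , λ x≢y fx≡fy → x≢y (f-inj fx≡fy)

irreflexive⟶Complete : (D : Digraph) → (∀ {x} → ¬ E D x x) → D ⟶ Complete (V D)
irreflexive⟶Complete D irrefl = id , λ { e refl → irrefl e }

K-mono : ∀ {m n} → m ≤ n → K m ⟶ K n
K-mono m≤n = Complete-map (λ x → inject≤ x m≤n) (inject≤-injective m≤n m≤n _ _)

EventuallyK₃ : Digraph → Set
EventuallyK₃ D = Σ[ i ∈ ℕ ] (δ^ i D ⟶ K₃)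

EventuallyK₃-pullback : {D H : Digraph} → D ⟶ H → EventuallyK₃ H → EventuallyK₃ D
EventuallyK₃-pullback {D} {H} h (i , g) = i , _∘ₕ_ {δ^ i D} {δ^ i H} {K₃} g (δ^-map i h)

EventuallyK₃-δ⁻ : {D : Digraph} → EventuallyK₃ (δ D) → EventuallyK₃ D
EventuallyK₃-δ⁻ {D} (i , g) = suc i , subst (_⟶ K₃) (δ^-δ i D) g

third : ∀ {k} (x y : Fin (3 + k)) → Σ[ z ∈ Fin (3 + k) ] (x ≢ z × y ≢ z)
third zero          zero          = suc zero , (λ ()) , (λ ())
third zero          (suc zero)    = suc (suc zero) , (λ ()) , (λ ())
third zero          (suc (suc _)) = suc zero , (λ ()) , (λ ())
third (suc zero)    zero          = suc (suc zero) , (λ ()) , (λ ())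
third (suc zero)    (suc zero)    = zero , (λ ()) , (λ ())
third (suc zero)    (suc (suc _)) = zero , (λ ()) , (λ ())
third (suc (suc _)) zero          = suc zero , (λ ()) , (λ ())
third (suc (suc _)) (suc zero)    = zero , (λ ()) , (λ ())
third (suc (suc _)) (suc (suc _)) = zero , (λ ()) , (λ ())

-- The apex of K (4 + k) is zero; the last clause only covers walks x → zero → z that
-- are not 2-walks of K (4 + k), so its value is irrelevant.
walkColour : ∀ {k} → Fin (4 + k) → Fin (4 + k) → Fin (4 + k) → Fin (3 + k)
walkColour x       (suc y) z       = y
walkColour (suc x) zero    (suc z) = proj₁ (third x z)
walkColour _       zero    _       = zero

walkColour-proper : ∀ {k} {x y z w : Fin (4 + k)} → x ≢ y → y ≢ z → z ≢ w →
                    walkColour x y z ≢ walkColour y z w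
walkColour-proper {y = zero}  {zero}  _   y≢z _   = λ _ → y≢z refl
walkColour-proper {y = suc y} {suc z} _   y≢z _   = λ y≡z → y≢z (cong suc y≡z)
walkColour-proper {y = suc y} {zero}  {zero}  _ _ z≢w = λ _ → z≢w refl
walkColour-proper {y = suc y} {zero}  {suc w} _ _ _   = proj₁ (proj₂ (third y w))
walkColour-proper {x = zero}  {zero}  {suc z} x≢y _ _ = λ _ → x≢y refl
walkColour-proper {x = suc x} {zero}  {suc z} _ _ _   = ≢-sym (proj₂ (proj₂ (third x z)))

δ²-K-suc⟶K : ∀ k → δ (δ (K (4 + k))) ⟶ K (3 + k)
δ²-K-suc⟶K k = colour , λ {u} {v} → proper u v
  where
  colour : Arc (δ (K (4 + k))) → Fin (3 + k)
  colour ((x , y , _) , (_ , z , _) , _) = walkColour x y z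

  proper : (u v : Arc (δ (K (4 + k)))) → head {δ (K (4 + k))} u ≡ tail {δ (K (4 + k))} v →
           colour u ≢ colour v
  proper ((x , y , x≢y) , (.y , z , y≢z) , refl) (_ , (.z , w , z≢w) , refl) refl =
    walkColour-proper x≢y y≢z z≢w

EventuallyK₃-K-3+ : ∀ k → EventuallyK₃ (K (3 + k))
EventuallyK₃-K-3+ zero    = 0 , id , id
EventuallyK₃-K-3+ (suc k) =
  EventuallyK₃-δ⁻ (EventuallyK₃-δ⁻ (EventuallyK₃-pullback (δ²-K-suc⟶K k) (EventuallyK₃-K-3+ k)))

EventuallyK₃-K : ∀ n → EventuallyK₃ (K n)
EventuallyK₃-K n = EventuallyK₃-pullback (K-mono (m≤n+m n 3)) (EventuallyK₃-K-3+ n)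

lemma4p20 : (n : ℕ) (adj : Fin n → Fin n → Bool) →
    (∀ v → adj v v ≡ false) →
    Σ[ i ∈ ℕ ] (δ^ i (finDigraph n adj) ⟶ K₃)
lemma4p20 n adj loopless =
  EventuallyK₃-pullback (irreflexive⟶Complete (finDigraph n adj) irreflexive) (EventuallyK₃-K n)
  where
  irreflexive : ∀ {v} → ¬ T (adj v v)
  irreflexive {v} = subst T (loopless v)
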